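{- Let $\mathrm{D}$ be either $\mathrm{D.LE}$ or an extension $\mathrm{D.LE}'$ of $\mathrm{D.LE}$ by analytic structural rules. For every sequent $x\Rightarrow y$, if $\not\vdash_{\mathrm{D}}x\Rightarrow y$ then $(\mathbb{F}^{x\Rightarrow y}_{\mathrm{D}})^+\not\models x\Rightarrow y$.
   Context: LE-signature $\mathcal{L}=\mathcal{L}(\mathcal{F},\mathcal{G})$: disjoint sets of connectives, each $h$ with arity $n_h$ and order type $\varepsilon_h\in\{1,\partial\}^{n_h}$ ($1^\partial=\partial,\partial^\partial=1$). Formulas: $\varphi::=p\mid\bot\mid\top\mid\varphi\wedge\varphi\mid\varphi\vee\varphi\mid f(\bar\varphi)\mid g(\bar\varphi)$. $\bar a^i_b$: $\bar a$ with $i$-th entry replaced by $b$. Residual symbols $f^\sharp_i$, $g^\flat_i$; $\mathcal{F}^*$ = $\mathcal{F}$ plus $f^\sharp_i$ with $\varepsilon_f(i)=\partial$ plus $g^\flat_i$ with $\varepsilon_g(i)=1$; $\mathcal{G}^*$ = $\mathcal{G}$ plus $f^\sharp_i$ with $\varepsilon_f(i)=1$ plus $g^\flat_i$ with $\varepsilon_g(i)=\partial$; $\varepsilon_{f^\sharp_i}(i)=\varepsilon_f(i)$, for $j\ne i$ $\varepsilon_{f^\sharp_i}(j)=\varepsilon_f(j)^\partial$ if $\varepsilon_f(i)=1$ and $=\varepsilon_f(j)$ otherwise (likewise $g^\flat_i$). Structures: sorts $\mathsf{Str}_\mathcal{F},\mathsf{Str}_\mathcal{G}$ containing all formulas, closed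 under $\mathsf{F}_h$ ($h\in\mathcal{F}^*$, into $\mathsf{Str}_\mathcal{F}$, argument $i$ in $\mathsf{Str}_\mathcal{F}$ if $\varepsilon_h(i)=1$, $\mathsf{Str}_\mathcal{G}$ if $\partial$) and $\mathsf{G}_h$ ($h\in\mathcal{G}^*$, dually). Sequents $x\Rightarrow y$, $x\in\mathsf{Str}_\mathcal{F}$, $y\in\mathsf{Str}_\mathcal{G}$. Rules of $\mathrm{D.LE}$: (Id) $p\Rightarrow p$; (Cut) $x\Rightarrow\varphi$, $\varphi\Rightarrow y$ / $x\Rightarrow y$; invertible display rules $\mathsf{F}_f(\bar x)\Rightarrow y$ iff $x_i\Rightarrow\mathsf{G}_{f^\sharp_i}(\bar x^i_y)$ ($\varepsilon_f(i)=1$), iff $\mathsf{F}_{f^\sharp_i}(\bar x^i_y)\Rightarrow x_i$ ($\varepsilon_f(i)=\partial$); $x\Rightarrow\mathsf{G}_g(\bar y)$ iff $\mathsf{F}_{g^\flat_i}(\bar y^i_x)\Rightarrow y_i$ ($\varepsilon_g(i)=1$), iff $y_i\Rightarrow\mathsf{G}_{g^\flat_i}(\bar y^i_x)$ ($\varepsilon_g(i)=\partial$); $\bot\Rightarrow y$; $x\Rightarrow\top$; $\varphi\Rightarrow y$ / $\varphi\wedge\psi\Rightarrow y$ and $\psi\wedge\varphi\Rightarrow y$; $x\Rightarrow\varphi$ / $x\Rightarrow\varphi\vee\psi$ and $x\Rightarrow\psi\vee\varphi$; $x\Rightarrow\varphi$, $x\Rightarrow\psi$ / $x\Rightarrow\varphi\wedge\psi$;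 $\varphi\Rightarrow y$, $\psi\Rightarrow y$ / $\varphi\vee\psi\Rightarrow y$; $\mathsf{F}_f(\bar\varphi)\Rightarrow y$ / $f(\bar\varphi)\Rightarrow y$; $x_i\Rightarrow\varphi_i$ ($\varepsilon_f(i)=1$), $\varphi_j\Rightarrow x_j$ ($\varepsilon_f(j)=\partial$) / $\mathsf{F}_f(\bar x)\Rightarrow f(\bar\varphi)$; $x\Rightarrow\mathsf{G}_g(\bar\psi)$ / $x\Rightarrow g(\bar\psi)$; $\psi_i\Rightarrow y_i$ ($\varepsilon_g(i)=1$), $y_j\Rightarrow\psi_j$ ($\varepsilon_g(j)=\partial$) / $g(\bar\psi)\Rightarrow\mathsf{G}_g(\bar y)$. Analytic structural rule: structural rule scheme satisfying Belnap's conditions C1–C7 for proper display calculi. $\vdash_{\mathrm{D}}$: derivability in $\mathrm{D}$. Polarity notation: $X^\uparrow=\{u:xNu\ \forall x\in X\}$, $Y^\downarrow=\{w:wNy\ \forall y\in Y\}$; stable sets $X=X^{\uparrow\downarrow}$. $W^\varepsilon=\prod_iW^{\varepsilon(i)}$ ($W^1=W$, $W^\partial=U$), $U^\varepsilon$ dually. For $S\subseteq A\times B_1\times\cdots\times B_n$: $S^{(0)}[C_1,..,C_n]=\{a:(a,\bar b)\in S\ \forall b_j\in C_j\}$. $(x\Rightarrow y)^\leftarrow$: smallest set of sequents containing $x\Rightarrow y$ and containing all premises of any rule instance of $\mathrm{D}$ whose conclusion is in it. $\mathbb{F}^{x\Rightarrow y}_{\mathrm{D}}=(W,U,N,\{R_f\},\{R_g\})$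 with $W=\mathsf{Str}_\mathcal{F}$, $U=\mathsf{Str}_\mathcal{G}$, $wNu$ iff $\vdash_{\mathrm{D}}w\Rightarrow u$ or $w\Rightarrow u\notin(x\Rightarrow y)^\leftarrow$, $R_f(u,\bar x)$ iff $\mathsf{F}_f(\bar x)Nu$, $R_g(w,\bar y)$ iff $wN\mathsf{G}_g(\bar y)$. Complex algebra $\mathbb{F}^+$ of such a structure: stable subsets of $W$ under inclusion, $f(X_1,..,X_n)=(R_f^{(0)}[X'_1,..,X'_n])^\downarrow$ ($X'_i=X_i$ if $\varepsilon_f(i)=1$, $X_i^\uparrow$ if $\partial$), $g(X_1,..,X_n)=R_g^{(0)}[X'_1,..,X'_n]$ ($X'_i=X_i^\uparrow$ if $\varepsilon_g(i)=1$, $X_i$ if $\partial$); it is a complete lattice expansion with residuals/Galois adjoints $f^\sharp_i,g^\flat_i$ in each coordinate ($f(\bar a)\le b\iff a_i\le f^\sharp_i(\bar a^i_b)$ if $\varepsilon_f(i)=1$, $\iff f^\sharp_i(\bar a^i_b)\le a_i$ if $\partial$; $b\le g(\bar a)\iff g^\flat_i(\bar a^i_b)\le a_i$ if $\varepsilon_g(i)=1$, $\iff a_i\le g^\flat_i(\bar a^i_b)$ if $\partial$). $\mathbb{F}^+\models x\Rightarrow y$ means $v(x)\subseteq v(y)$ for every assignment $v$ of atoms, extended homomorphically to structures (interpreting $\mathsf{F}_h,\mathsf{G}_h$ as $h$, $f^\sharp_i$ or $g^\flat_i$). -}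

module Defs where

open import Data.Nat using (ℕ; _≤_; _+_; zero; suc)
import Data.Nat as ℕ
open import Data.Fin using (Fin)
import Data.Fin as Fin
open import Data.Vec using (Vec; []; _∷_; lookup; tabulate; _[_]≔_; toList)
import Data.Vec as Vec
open import Data.List using (List; []; _∷_; map)
open import Data.List.Relation.Unary.All using (All)
open import Data.List.Membership.Propositional using (_∈_)
open import Data.Product using (Σ; _×_; _,_; proj₁; proj₂)
open import Data.Sum using (_⊎_)
open import Data.Unit using (⊤)
open import Data.Empty using (⊥)
open import Data.Bool using (Bool; true; false; _∧_; if_then_else_)
open import Relation.Nullary using (¬_; yes; no; does)
open import Relation.Binary.PropositionalEquality using (_≡_)

-- Order types: 1 (written one) and ∂ (written par)

data Pol : Set where
  one par : Pol

flip : Pol → Pol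
flip one = par
flip par = one

samePol : Pol → Pol → Bool
samePol one one = true
samePol par par = true
samePol _   _   = false

-- LE-signature L(F,G) over a set of proposition letters.
-- F and G are disjoint because they are separate types.

record Sig : Set₁ where
  field
    Atom : Set
    FCon : Set
    GCon : Set
    arF  : FCon → ℕ
    εF   : (f : FCon) → Fin (arF f) → Pol
    arG  : GCon → ℕ
    εG   : (g : GCon) → Fin (arG g) → Pol

module _ (L : Sig) where
  open Sig L

  -- order type of a residual h^♯_i / h^♭_i of an n-ary h with order type ε
  resε : (n : ℕ) (ε : Fin n → Pol) (i : Fin n) → Fin n → Pol
  resε n ε i j with j Fin.≟ i | ε i
  ... | yes _ | _   = ε i
  ... | no _  | one = flip (ε j)
  ... | no _  | par = ε j

  data FS : Set where
    fB  : FCon → FS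
    fSh : (f : FCon) (i : Fin (arF f)) → εF f i ≡ par → FS
    gFl : (g : GCon) (i : Fin (arG g)) → εG g i ≡ one → FS

  data GS : Set where
    gB  : GCon → GS
    fSh : (f : FCon) (i : Fin (arF f)) → εF f i ≡ one → GS
    gFl : (g : GCon) (i : Fin (arG g)) → εG g i ≡ par → GS

  arFS : FS → ℕ
  arFS (fB f)      = arF f
  arFS (fSh f _ _) = arF f
  arFS (gFl g _ _) = arG g

  εFS : (h : FS) → Fin (arFS h) → Pol
  εFS (fB f)      = εF f
  εFS (fSh f i _) = resε (arF f) (εF f) i
  εFS (gFl g i _) = resε (arG g) (εG g) i

  arGS : GS → ℕ
  arGS (gB g)      = arG g
  arGS (fSh f _ _) = arF f
  arGS (gFl g _ _) = arG g

  εGS : (h : GS) → Fin (arGS h) → Pol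
  εGS (gB g)      = εG g
  εGS (fSh f i _) = resε (arF f) (εF f) i
  εGS (gFl g i _) = resε (arG g) (εG g) i

  data Fm : Set where
    at    : Atom → Fm
    botF  : Fm
    topF  : Fm
    _∧F_  : Fm → Fm → Fm
    _∨F_  : Fm → Fm → Fm
    fc    : (f : FCon) → Vec Fm (arF f) → Fm
    gc    : (g : GCon) → Vec Fm (arG g) → Fm

  -- raw structures (sorts are imposed by the predicate Sorted below)
  data Str : Set where
    fm : Fm → Str
    SF : (h : FS) → Vec Str (arFS h) → Str
    SG : (h : GS) → Vec Str (arGS h) → Str

  -- Sorted one s : s ∈ Str_F ;  Sorted par s : s ∈ Str_G
  mutual
    Sorted : Pol → Str → Set
    Sorted _   (fm _)    = ⊤
    Sorted one (SF h xs) = SortedV (εFS h) xs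
    Sorted par (SF h xs) = ⊥
    Sorted one (SG h ys) = ⊥
    Sorted par (SG h ys) = SortedV (λ i → flip (εGS h i)) ys

    SortedV : {n : ℕ} → (Fin n → Pol) → Vec Str n → Set
    SortedV ε []       = ⊤
    SortedV ε (x ∷ xs) = Sorted (ε Fin.zero) x × SortedV (λ i → ε (Fin.suc i)) xs

  El : Pol → Set
  El p = Σ Str (Sorted p)

  Seq : Set
  Seq = Str × Str

  -- Structural rule schemes (structure variables and structural
  -- connectives only; a variable is a pair (sort, index)).

  data Sch : Set where
    sv : Pol → ℕ → Sch
    sF : (h : FS) → Vec Sch (arFS h) → Sch
    sG : (h : GS) → Vec Sch (arGS h) → Sch

  mutual
    sub : (Pol → ℕ → Str) → Sch → Str
    sub σ (sv p n)  = σ p n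
    sub σ (sF h xs) = SF h (subV σ xs)
    sub σ (sG h ys) = SG h (subV σ ys)

    subV : {n : ℕ} → (Pol → ℕ → Str) → Vec Sch n → Vec Str n
    subV σ []       = []
    subV σ (x ∷ xs) = sub σ x ∷ subV σ xs

  subSeq : (Pol → ℕ → Str) → Sch × Sch → Seq
  subSeq σ (a , b) = sub σ a , sub σ b

  mutual
    SchSorted : Pol → Sch → Set
    SchSorted p   (sv q _)  = q ≡ p
    SchSorted one (sF h xs) = SchSortedV (εFS h) xs
    SchSorted par (sF h xs) = ⊥
    SchSorted one (sG h ys) = ⊥
    SchSorted par (sG h ys) = SchSortedV (λ i → flip (εGS h i)) ys

    SchSortedV : {n : ℕ} → (Fin n → Pol) → Vec Sch n → Set
    SchSortedV ε []       = ⊤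
    SchSortedV ε (x ∷ xs) = SchSorted (ε Fin.zero) x × SchSortedV (λ i → ε (Fin.suc i)) xs

  mutual
    occ : Pol → ℕ → Sch → ℕ
    occ p n (sv q m)  = if samePol p q ∧ does (n ℕ.≟ m) then 1 else 0
    occ p n (sF h xs) = occV p n xs
    occ p n (sG h ys) = occV p n ys

    occV : {k : ℕ} → Pol → ℕ → Vec Sch k → ℕ
    occV p n []       = 0
    occV p n (x ∷ xs) = occ p n x + occV p n xs

  occS : Pol → ℕ → Sch × Sch → ℕ
  occS p n (a , b) = occ p n a + occ p n b

  record Rule : Set where
    field
      prems : List (Sch × Sch)
      concl : Sch × Sch

  WellSortedSeq : Sch × Sch → Set
  WellSortedSeq (a , b) = SchSorted one a × SchSorted par b

  -- Analytic structural rule (Belnap's C1–C7, specialised to pure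
  -- structural rule schemes)
  record Analytic (r : Rule) : Set where
    open Rule r
    field
      conclSorted : WellSortedSeq concl
      premsSorted : All WellSortedSeq prems
      -- C1: every variable of a premise occurs in the conclusion
      preserve    : All (λ s → ∀ p n → 1 ≤ occS p n s → 1 ≤ occS p n concl) prems
      -- C3: non-proliferation: each variable occurs at most once in the conclusion
      nonProlif   : ∀ p n → occS p n concl ≤ 1

  premF : Pol → Str → Fm → Seq
  premF one x φ = x , fm φ
  premF par x φ = fm φ , x

  premG : Pol → Fm → Str → Seq
  premG one ψ y = fm ψ , y
  premG par ψ y = y , fm ψ

  data DLEInst : List Seq → Seq → Set where
    idR   : (p : Atom) → DLEInst [] (fm (at p) , fm (at p))
    cutR  : (x : Str) (φ : Fm) (y : Str) →
            DLEInst ((x , fm φ) ∷ (fm φ , y) ∷ []) (x , y)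
    dF1↓  : (f : FCon) (xs : Vec Str (arF f)) (y : Str) (i : Fin (arF f)) (e : εF f i ≡ one) →
            DLEInst ((SF (fB f) xs , y) ∷ []) (lookup xs i , SG (fSh f i e) (xs [ i ]≔ y))
    dF1↑  : (f : FCon) (xs : Vec Str (arF f)) (y : Str) (i : Fin (arF f)) (e : εF f i ≡ one) →
            DLEInst ((lookup xs i , SG (fSh f i e) (xs [ i ]≔ y)) ∷ []) (SF (fB f) xs , y)
    dF∂↓  : (f : FCon) (xs : Vec Str (arF f)) (y : Str) (i : Fin (arF f)) (e : εF f i ≡ par) →
            DLEInst ((SF (fB f) xs , y) ∷ []) (SF (fSh f i e) (xs [ i ]≔ y) , lookup xs i)
    dF∂↑  : (f : FCon) (xs : Vec Str (arF f)) (y : Str) (i : Fin (arF f)) (e : εF f i ≡ par) →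
            DLEInst ((SF (fSh f i e) (xs [ i ]≔ y) , lookup xs i) ∷ []) (SF (fB f) xs , y)
    dG1↓  : (g : GCon) (ys : Vec Str (arG g)) (x : Str) (i : Fin (arG g)) (e : εG g i ≡ one) →
            DLEInst ((x , SG (gB g) ys) ∷ []) (SF (gFl g i e) (ys [ i ]≔ x) , lookup ys i)
    dG1↑  : (g : GCon) (ys : Vec Str (arG g)) (x : Str) (i : Fin (arG g)) (e : εG g i ≡ one) →
            DLEInst ((SF (gFl g i e) (ys [ i ]≔ x) , lookup ys i) ∷ []) (x , SG (gB g) ys)
    dG∂↓  : (g : GCon) (ys : Vec Str (arG g)) (x : Str) (i : Fin (arG g)) (e : εG g i ≡ par) →
            DLEInst ((x , SG (gB g) ys) ∷ []) (lookup ys i , SG (gFl g i e) (ys [ i ]≔ x))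
    dG∂↑  : (g : GCon) (ys : Vec Str (arG g)) (x : Str) (i : Fin (arG g)) (e : εG g i ≡ par) →
            DLEInst ((lookup ys i , SG (gFl g i e) (ys [ i ]≔ x)) ∷ []) (x , SG (gB g) ys)
    botL  : (y : Str) → DLEInst [] (fm botF , y)
    topR  : (x : Str) → DLEInst [] (x , fm topF)
    ∧L₁   : (φ ψ : Fm) (y : Str) → DLEInst ((fm φ , y) ∷ []) (fm (φ ∧F ψ) , y)
    ∧L₂   : (φ ψ : Fm) (y : Str) → DLEInst ((fm φ , y) ∷ []) (fm (ψ ∧F φ) , y)
    ∨R₁   : (φ ψ : Fm) (x : Str) → DLEInst ((x , fm φ) ∷ []) (x , fm (φ ∨F ψ))
    ∨R₂   : (φ ψ : Fm) (x : Str) → DLEInst ((x , fm φ) ∷ []) (x , fm (ψ ∨F φ))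
    ∧R    : (φ ψ : Fm) (x : Str) → DLEInst ((x , fm φ) ∷ (x , fm ψ) ∷ []) (x , fm (φ ∧F ψ))
    ∨L    : (φ ψ : Fm) (y : Str) → DLEInst ((fm φ , y) ∷ (fm ψ , y) ∷ []) (fm (φ ∨F ψ) , y)
    fL    : (f : FCon) (φs : Vec Fm (arF f)) (y : Str) →
            DLEInst ((SF (fB f) (Vec.map fm φs) , y) ∷ []) (fm (fc f φs) , y)
    fR    : (f : FCon) (xs : Vec Str (arF f)) (φs : Vec Fm (arF f)) →
            DLEInst (toList (tabulate (λ i → premF (εF f i) (lookup xs i) (lookup φs i))))
                    (SF (fB f) xs , fm (fc f φs))
    gR    : (g : GCon) (ψs : Vec Fm (arG g)) (x : Str) →
            DLEInst ((x , SG (gB g) (Vec.map fm ψs)) ∷ []) (x , fm (gc g ψs))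
    gL    : (g : GCon) (ψs : Vec Fm (arG g)) (ys : Vec Str (arG g)) →
            DLEInst (toList (tabulate (λ i → premG (εG g i) (lookup ψs i) (lookup ys i))))
                    (fm (gc g ψs) , SG (gB g) ys)

  -- The calculus D = D.LE extended with the structural rules ρ i (i : I)
  -- (D.LE itself is the case I = ⊥).

  module _ {I : Set} (ρ : I → Rule) where

    data Inst : List Seq → Seq → Set where
      dle : ∀ {ps s} → DLEInst ps s → Inst ps s
      str : (i : I) (σ : Pol → ℕ → Str) → (∀ p n → Sorted p (σ p n)) →
            Inst (map (subSeq σ) (Rule.prems (ρ i))) (subSeq σ (Rule.concl (ρ i)))

    data Derivable (s : Seq) : Set where
      der : (ps : List Seq) → Inst ps s → All Derivable ps → Derivable s

    data Closure (s₀ : Seq) : Seq → Set where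
      base : Closure s₀ s₀
      step : ∀ {ps c s} → Closure s₀ c → Inst ps c → s ∈ ps → Closure s₀ s

    module _ (s₀ : Seq) where

      W U : Set
      W = El one
      U = El par

      Nraw : Str → Str → Set
      Nraw w u = Derivable (w , u) ⊎ ¬ Closure s₀ (w , u)

      N : W → U → Set
      N w u = Nraw (proj₁ w) (proj₁ u)

      PW : Set₁
      PW = W → Set

      _⊆_ : {A : Set} → (A → Set) → (A → Set) → Set
      X ⊆ Y = ∀ a → X a → Y a

      up : PW → (U → Set)
      up X u = ∀ w → X w → N w u

      down : (U → Set) → PW
      down Y w = ∀ u → Y u → N w u

      Stable : PW → Set
      Stable X = down (up X) ⊆ X

      Rf : (f : FCon) → U → ((i : Fin (arF f)) → El (εF f i)) → Set
      Rf f u xs = Nraw (SF (fB f) (tabulate (λ i → proj₁ (xs i)))) (proj₁ u)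

      Rg : (g : GCon) → W → ((i : Fin (arG g)) → El (flip (εG g i))) → Set
      Rg g w ys = Nraw (proj₁ w) (SG (gB g) (tabulate (λ i → proj₁ (ys i))))

      primeF : (p : Pol) → PW → El p → Set
      primeF one X = X
      primeF par X = up X

      primeG : (p : Pol) → PW → El (flip p) → Set
      primeG one X = up X
      primeG par X = X

      fOp : (f : FCon) → Vec PW (arF f) → PW
      fOp f as = down (λ u → (xs : (i : Fin (arF f)) → El (εF f i)) →
                              (∀ i → primeF (εF f i) (lookup as i) (xs i)) → Rf f u xs)

      gOp : (g : GCon) → Vec PW (arG g) → PW
      gOp g as w = (ys : (i : Fin (arG g)) → El (flip (εG g i))) →
                   (∀ i → primeG (εG g i) (lookup as i) (ys i)) → Rg g w ys

      ptDown : U → PW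
      ptDown u w = N w u

      ptCl : W → PW
      ptCl w w' = ∀ u → N w u → N w' u

      -- residuals / adjoints in the complete lattice F^+ :
      -- least (resp. greatest) stable set satisfying the adjunction,
      -- written as a meet of principal {u}^↓ (resp. join of principal {w}^↑↓).
      fShOpF : (f : FCon) (i : Fin (arF f)) → Vec PW (arF f) → PW
      fShOpF f i as w = ∀ u → fOp f (as [ i ]≔ ptDown u) ⊆ lookup as i → N w u

      fShOpG : (f : FCon) (i : Fin (arF f)) → Vec PW (arF f) → PW
      fShOpG f i as w = fOp f (as [ i ]≔ ptCl w) ⊆ lookup as i

      gFlOpF : (g : GCon) (i : Fin (arG g)) → Vec PW (arG g) → PW
      gFlOpF g i as w = ∀ u → lookup as i ⊆ gOp g (as [ i ]≔ ptDown u) → N w u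

      gFlOpG : (g : GCon) (i : Fin (arG g)) → Vec PW (arG g) → PW
      gFlOpG g i as w = lookup as i ⊆ gOp g (as [ i ]≔ ptCl w)

      module _ (v : Atom → PW) where
        mutual
          ⟦_⟧f : Fm → PW
          ⟦ at p ⟧f     = v p
          ⟦ botF ⟧f     = down (up (λ _ → ⊥))
          ⟦ topF ⟧f     = λ _ → ⊤
          ⟦ φ ∧F ψ ⟧f   = λ w → ⟦ φ ⟧f w × ⟦ ψ ⟧f w
          ⟦ φ ∨F ψ ⟧f   = down (up (λ w → ⟦ φ ⟧f w ⊎ ⟦ ψ ⟧f w))
          ⟦ fc f φs ⟧f  = fOp f ⟦ φs ⟧fV
          ⟦ gc g ψs ⟧f  = gOp g ⟦ ψs ⟧fV

          ⟦_⟧fV : {n : ℕ} → Vec Fm n → Vec PW n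
          ⟦ [] ⟧fV     = []
          ⟦ φ ∷ φs ⟧fV = ⟦ φ ⟧f ∷ ⟦ φs ⟧fV

        mutual
          ⟦_⟧ : Str → PW
          ⟦ fm φ ⟧               = ⟦ φ ⟧f
          ⟦ SF (fB f) xs ⟧       = fOp f ⟦ xs ⟧V
          ⟦ SF (fSh f i _) xs ⟧  = fShOpF f i ⟦ xs ⟧V
          ⟦ SF (gFl g i _) ys ⟧  = gFlOpF g i ⟦ ys ⟧V
          ⟦ SG (gB g) ys ⟧       = gOp g ⟦ ys ⟧V
          ⟦ SG (fSh f i _) xs ⟧  = fShOpG f i ⟦ xs ⟧V
          ⟦ SG (gFl g i _) ys ⟧  = gFlOpG g i ⟦ ys ⟧V

          ⟦_⟧V : {n : ℕ} → Vec Str n → Vec PW n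
          ⟦ [] ⟧V     = []
          ⟦ x ∷ xs ⟧V = ⟦ x ⟧ ∷ ⟦ xs ⟧V

      Models : Seq → Set₁
      Models (x , y) = (v : Atom → PW) → (∀ p → Stable (v p)) → ⟦_⟧ v x ⊆ ⟦_⟧ v y

{-# OPTIONS --safe #-}
-- Take the canonical valuation v₀ p = {p}↓.  The truth lemma says that every
-- x ∈ Str_F lies in ⟦x⟧ and that ⟦y⟧ ⊆ {y}↓ for every y ∈ Str_G; it is proved by
-- induction on structures, each case being one display or operational rule of
-- D.LE.  The relation N respects every rule instance of D: either all premises
-- are derivable, or one lies outside (x ⇒ y)^←, and then so does the conclusion.
-- If the complex algebra validated x ⇒ y we would get x ∈ ⟦x⟧ ⊆ ⟦y⟧ ⊆ {y}↓,
-- i.e. x N y; as x ⇒ y belongs to its own closure, it would be derivable.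
module Submission where

open import Defs
open import Data.Product using (_,_)
open import Relation.Nullary using (¬_)

open import Data.Nat using (ℕ)
open import Data.Fin using (Fin; zero; suc; _≟_)
open import Data.Vec using (Vec; []; _∷_; lookup; tabulate; _[_]≔_; map)
open import Data.Vec.Properties
  using ( lookup∘update; lookup∘update′; []≔-idempotent; []≔-lookup
        ; tabulate∘lookup; lookup∘tabulate; tabulate-∘)
open import Data.Vec.Relation.Unary.All.Properties using (tabulate⁺; toList⁺)
open import Data.List using (List; []; _∷_)
open import Data.List.Relation.Unary.All using (All; []; _∷_)
open import Data.List.Relation.Unary.Any using (Any; here; there)
open import Data.List.Membership.Propositional using (find)
open import Data.Product using (_×_; proj₁; proj₂)
open import Data.Sum using (_⊎_; inj₁; inj₂)
import Data.Sum as Sum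
open import Data.Unit using (tt)
open import Data.Empty using (⊥-elim)
open import Function using (_∘_)
open import Relation.Nullary using (yes; no)
open import Relation.Binary.PropositionalEquality
  using (_≡_; _≢_; refl; sym; trans; cong; subst; subst₂)

flip-involutive : ∀ p → flip (flip p) ≡ p
flip-involutive one = refl
flip-involutive par = refl

All⊎Any : {A : Set} {P Q : A → Set} {xs : List A} →
          All (λ x → P x ⊎ Q x) xs → All P xs ⊎ Any Q xs
All⊎Any []              = inj₁ []
All⊎Any (inj₁ px ∷ pxs) = Sum.map (px ∷_) there (All⊎Any pxs)
All⊎Any (inj₂ qx ∷ _)   = inj₂ (here qx)

tabulate-∘lookup : {A B : Set} {n : ℕ} (f : A → B) (xs : Vec A n) →
                   tabulate (f ∘ lookup xs) ≡ map f xs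
tabulate-∘lookup f xs = trans (tabulate-∘ f (lookup xs)) (cong (map f) (tabulate∘lookup xs))

[]≔-restore : {A : Set} {n : ℕ} (xs : Vec A n) (i : Fin n) (z : A) →
              (xs [ i ]≔ z) [ i ]≔ lookup xs i ≡ xs
[]≔-restore xs i z = trans ([]≔-idempotent xs i) ([]≔-lookup xs i)

module Sorting (L : Sig) where
  open Sig L

  resε-self : ∀ n (ε : Fin n → Pol) i → resε L n ε i i ≡ ε i
  resε-self n ε i with i ≟ i
  ... | yes _   = refl
  ... | no i≢i = ⊥-elim (i≢i refl)

  resε-par : ∀ n (ε : Fin n → Pol) i → ε i ≡ par → ∀ j → resε L n ε i j ≡ ε j
  resε-par n ε i εi≡par j with j ≟ i
  ... | yes refl = refl
  ... | no _ rewrite εi≡par = refl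

  resε-one : ∀ n (ε : Fin n → Pol) i → ε i ≡ one →
             ∀ j → j ≢ i → resε L n ε i j ≡ flip (ε j)
  resε-one n ε i εi≡one j j≢i with j ≟ i
  ... | yes j≡i = ⊥-elim (j≢i j≡i)
  ... | no _ rewrite εi≡one = refl

  SortedV-lookup⁺ : ∀ {n} {ε : Fin n → Pol} {xs : Vec (Str L) n} →
                    SortedV L ε xs → ∀ j → Sorted L (ε j) (lookup xs j)
  SortedV-lookup⁺ {xs = x ∷ xs} (sx , sxs) zero    = sx
  SortedV-lookup⁺ {xs = x ∷ xs} (sx , sxs) (suc j) = SortedV-lookup⁺ sxs j

  SortedV-lookup⁻ : ∀ {n} {ε : Fin n → Pol} (xs : Vec (Str L) n) →
                    (∀ j → Sorted L (ε j) (lookup xs j)) → SortedV L ε xs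
  SortedV-lookup⁻ []       sorted = tt
  SortedV-lookup⁻ (x ∷ xs) sorted = sorted zero , SortedV-lookup⁻ xs (sorted ∘ suc)

  SortedV-tabulate : ∀ {n} {ε : Fin n → Pol} {F : Fin n → Str L} →
                     (∀ j → Sorted L (ε j) (F j)) → SortedV L ε (tabulate F)
  SortedV-tabulate {ε = ε} {F} sorted =
    SortedV-lookup⁻ (tabulate F) (λ j → subst (Sorted L (ε j)) (sym (lookup∘tabulate F j)) (sorted j))

  Sorted-cast : ∀ {p q} x → p ≡ q → Sorted L p x → Sorted L q x
  Sorted-cast x refl sx = sx

  SortedV-lookup-cast : ∀ {n} {ε : Fin n → Pol} {xs : Vec (Str L) n} {p} →
                        SortedV L ε xs → ∀ j → ε j ≡ p → Sorted L p (lookup xs j)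
  SortedV-lookup-cast {xs = xs} sxs j εj≡p = Sorted-cast (lookup xs j) εj≡p (SortedV-lookup⁺ sxs j)

  SortedV-[]≔ : ∀ {n} {ε ε′ : Fin n → Pol} {xs : Vec (Str L) n} {i z} →
                SortedV L ε xs → Sorted L (ε′ i) z → (∀ j → j ≢ i → ε j ≡ ε′ j) →
                SortedV L ε′ (xs [ i ]≔ z)
  SortedV-[]≔ {ε = ε} {ε′} {xs} {i} {z} sxs sz ε≡ε′ = SortedV-lookup⁻ (xs [ i ]≔ z) sorted
    where
    sorted : ∀ j → Sorted L (ε′ j) (lookup (xs [ i ]≔ z) j)
    sorted j with j ≟ i
    ... | yes refl = subst (Sorted L (ε′ i)) (sym (lookup∘update i xs z)) sz
    ... | no j≢i   = subst (Sorted L (ε′ j)) (sym (lookup∘update′ j≢i xs z))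
                       (SortedV-lookup-cast sxs j (ε≡ε′ j j≢i))

module Canonical (L : Sig) {I : Set} (ρ : I → Rule L) (s₀ : Seq L) where
  open Sig L
  open Sorting L

  Nₛ : Seq L → Set
  Nₛ s = Derivable L ρ s ⊎ ¬ Closure L ρ s₀ s

  infix 4 _N₀_
  _N₀_ : Str L → Str L → Set
  w N₀ u = Nₛ (w , u)

  N-closed : ∀ {ps c} → Inst L ρ ps c → All Nₛ ps → Nₛ c
  N-closed inst premises with All⊎Any premises
  ... | inj₁ derivable = inj₁ (der _ inst derivable)
  ... | inj₂ outside   =
    let _ , s∈ps , s∉ = find outside in inj₂ (λ c∈ → s∉ (step c∈ inst s∈ps))

  N-closed₀ : ∀ {c} → DLEInst L [] c → Nₛ c
  N-closed₀ inst = N-closed (dle inst) []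

  N-closed₁ : ∀ {p c} → DLEInst L (p ∷ []) c → Nₛ p → Nₛ c
  N-closed₁ inst np = N-closed (dle inst) (np ∷ [])

  N-closed₂ : ∀ {p q c} → DLEInst L (p ∷ q ∷ []) c → Nₛ p → Nₛ q → Nₛ c
  N-closed₂ inst np nq = N-closed (dle inst) (np ∷ nq ∷ [])

  PW₀ : Set₁
  PW₀ = PW L ρ s₀

  ↓_ : U L ρ s₀ → PW₀
  ↓_ = ptDown L ρ s₀

  ↑↓_ : W L ρ s₀ → PW₀
  ↑↓_ = ptCl L ρ s₀

  primeF₀ : (p : Pol) → PW₀ → El L p → Set
  primeF₀ = primeF L ρ s₀

  primeG₀ : (p : Pol) → PW₀ → El L (flip p) → Set
  primeG₀ = primeG L ρ s₀

  primeG-flip : ∀ p X z → primeF₀ (flip p) X z → primeG₀ p X z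
  primeG-flip one X z h = h
  primeG-flip par X z h = h

  ↓-primeF : ∀ {p} → p ≡ par → (u : U L ρ s₀) → ∀ s → primeF₀ p (↓ u) (proj₁ u , s)
  ↓-primeF refl u s w wNu = wNu

  ↓-primeG : ∀ {p} → p ≡ one → (u : U L ρ s₀) → ∀ s → primeG₀ p (↓ u) (proj₁ u , s)
  ↓-primeG refl u s w wNu = wNu

  ↑↓-primeF : ∀ {p} → p ≡ one → (w : W L ρ s₀) → ∀ s → primeF₀ p (↑↓ w) (proj₁ w , s)
  ↑↓-primeF refl w s u wNu = wNu

  ↑↓-primeG : ∀ {p} → p ≡ par → (w : W L ρ s₀) → ∀ s → primeG₀ p (↑↓ w) (proj₁ w , s)
  ↑↓-primeG refl w s u wNu = wNu

  subst-El : ∀ {p} (Q : PW₀ → El L p → Set) {X X′ x x′} → X ≡ X′ → x ≡ x′ →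
             (∀ s → Q X (x , s)) → ∀ s → Q X′ (x′ , s)
  subst-El Q refl refl h = h

  []≔-pointwise : ∀ {n} (π : Fin n → Pol) (Q : ∀ j → PW₀ → El L (π j) → Set)
                  (as : Vec PW₀ n) (xs : Vec (Str L) n) i {a z} →
                  (∀ j → j ≢ i → ∀ s → Q j (lookup as j) (lookup xs j , s)) →
                  (∀ s → Q i a (z , s)) →
                  ∀ j s → Q j (lookup (as [ i ]≔ a) j) (lookup (xs [ i ]≔ z) j , s)
  []≔-pointwise π Q as xs i {a} {z} off at-i j with j ≟ i
  ... | yes refl = subst-El (Q i) (sym (lookup∘update i as a)) (sym (lookup∘update i xs z)) at-i
  ... | no j≢i   =
    subst-El (Q j) (sym (lookup∘update′ j≢i as a)) (sym (lookup∘update′ j≢i xs z)) (off j j≢i)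

  fOp-∋ : (f : FCon) (as : Vec PW₀ (arF f)) (zs : Vec (Str L) (arF f))
          (sz : Sorted L one (SF (fB f) zs)) →
          (∀ j s → primeF₀ (εF f j) (lookup as j) (lookup zs j , s)) →
          fOp L ρ s₀ f as (SF (fB f) zs , sz)
  fOp-∋ f as zs sz primes u k =
    subst (λ t → SF (fB f) t N₀ proj₁ u) (tabulate∘lookup zs)
      (k (λ j → lookup zs j , SortedV-lookup⁺ sz j) (λ j → primes j _))

  gOp-N : (g : GCon) (as : Vec PW₀ (arG g)) (w : W L ρ s₀) → gOp L ρ s₀ g as w →
          (ys : Vec (Str L) (arG g)) (sy : Sorted L par (SG (gB g) ys)) →
          (∀ j s → primeG₀ (εG g j) (lookup as j) (lookup ys j , s)) → proj₁ w N₀ SG (gB g) ys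
  gOp-N g as w w∈ ys sy primes =
    subst (λ t → proj₁ w N₀ SG (gB g) t) (tabulate∘lookup ys)
      (w∈ (λ j → lookup ys j , SortedV-lookup⁺ sy j) (λ j → primes j _))

  ptDown-stable : (u : U L ρ s₀) → Stable L ρ s₀ (↓ u)
  ptDown-stable u w w∈ = w∈ u (λ _ w′Nu → w′Nu)

  down-stable : (Y : U L ρ s₀ → Set) → Stable L ρ s₀ (down L ρ s₀ Y)
  down-stable Y w w∈ u u∈Y = w∈ u (λ w′ w′∈ → w′∈ u u∈Y)

  ∩-stable : {X Y : PW₀} → Stable L ρ s₀ X → Stable L ρ s₀ Y →
             Stable L ρ s₀ (λ w → X w × Y w)
  ∩-stable X-stable Y-stable w w∈ =
    X-stable w (λ u X⊆↓u → w∈ u (λ w′ → X⊆↓u w′ ∘ proj₁)) ,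
    Y-stable w (λ u Y⊆↓u → w∈ u (λ w′ → Y⊆↓u w′ ∘ proj₂))

  gOp-stable : (g : GCon) (as : Vec PW₀ (arG g)) → Stable L ρ s₀ (gOp L ρ s₀ g as)
  gOp-stable g as w w∈ ys primes =
    w∈ (SG (gB g) (tabulate (proj₁ ∘ ys)) , SortedV-tabulate (proj₂ ∘ ys))
       (λ w′ w′∈ → w′∈ ys primes)

  v₀ : Atom → PW₀
  v₀ p = ↓ (fm (at p) , tt)

  ⟦_⟧₀f : Fm L → PW₀
  ⟦_⟧₀f = ⟦_⟧f L ρ s₀ v₀

  ⟦_⟧₀fV : ∀ {n} → Vec (Fm L) n → Vec PW₀ n
  ⟦_⟧₀fV = ⟦_⟧fV L ρ s₀ v₀

  ⟦_⟧₀ : Str L → PW₀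
  ⟦_⟧₀ = ⟦_⟧ L ρ s₀ v₀

  ⟦_⟧₀V : ∀ {n} → Vec (Str L) n → Vec PW₀ n
  ⟦_⟧₀V = ⟦_⟧V L ρ s₀ v₀

  ⟦⟧f-stable : ∀ φ → Stable L ρ s₀ ⟦ φ ⟧₀f
  ⟦⟧f-stable (at p)    = ptDown-stable _
  ⟦⟧f-stable botF      = down-stable _
  ⟦⟧f-stable topF      = λ _ _ → tt
  ⟦⟧f-stable (φ ∧F ψ)  = ∩-stable (⟦⟧f-stable φ) (⟦⟧f-stable ψ)
  ⟦⟧f-stable (φ ∨F ψ)  = down-stable _
  ⟦⟧f-stable (fc f φs) = down-stable _
  ⟦⟧f-stable (gc g ψs) = gOp-stable g ⟦ ψs ⟧₀fV

  premF-N : ∀ p {X φ} → primeF₀ one X (fm φ , tt) → primeF₀ par X (fm φ , tt) →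
            (z : El L p) → primeF₀ p X z → Nₛ (premF L p (proj₁ z) φ)
  premF-N one φ∈X X⊆↓φ z z∈X   = X⊆↓φ z z∈X
  premF-N par φ∈X X⊆↓φ z X⊆↓z = X⊆↓z _ φ∈X

  premG-N : ∀ p {X ψ} → primeF₀ one X (fm ψ , tt) → primeF₀ par X (fm ψ , tt) →
            (z : El L (flip p)) → primeG₀ p X z → Nₛ (premG L p ψ (proj₁ z))
  premG-N one ψ∈X X⊆↓ψ z X⊆↓z = X⊆↓z _ ψ∈X
  premG-N par ψ∈X X⊆↓ψ z z∈X   = X⊆↓ψ z z∈X

  mutual
    fm∈⟦fm⟧ : ∀ φ → ⟦ φ ⟧₀f (fm φ , tt)
    fm∈⟦fm⟧ (at p)    = N-closed₀ (idR p)
    fm∈⟦fm⟧ botF      = λ u _ → N-closed₀ (botL (proj₁ u))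
    fm∈⟦fm⟧ topF      = tt
    fm∈⟦fm⟧ (φ ∧F ψ)  =
      ⟦⟧f-stable φ _ (λ u φ⊆↓u → N-closed₁ (∧L₁ φ ψ (proj₁ u)) (φ⊆↓u _ (fm∈⟦fm⟧ φ))) ,
      ⟦⟧f-stable ψ _ (λ u ψ⊆↓u → N-closed₁ (∧L₂ ψ φ (proj₁ u)) (ψ⊆↓u _ (fm∈⟦fm⟧ ψ)))
    fm∈⟦fm⟧ (φ ∨F ψ)  = λ u φ∨ψ⊆↓u →
      N-closed₂ (∨L φ ψ (proj₁ u))
        (φ∨ψ⊆↓u _ (inj₁ (fm∈⟦fm⟧ φ))) (φ∨ψ⊆↓u _ (inj₂ (fm∈⟦fm⟧ ψ)))
    fm∈⟦fm⟧ (fc f φs) = λ u k →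
      N-closed₁ (fL f φs (proj₁ u))
        (subst (λ t → SF (fB f) t N₀ proj₁ u) (tabulate-∘lookup fm φs)
          (k (λ j → fm (lookup φs j) , tt) (λ j → fm-truthV φs (εF f j) j)))
    fm∈⟦fm⟧ (gc g ψs) = λ ys primes →
      N-closed (dle (gL g ψs (tabulate (proj₁ ∘ ys)))) (toList⁺ (tabulate⁺ λ j →
        subst (λ t → Nₛ (premG L (εG g j) (lookup ψs j) t)) (sym (lookup∘tabulate (proj₁ ∘ ys) j))
          (premG-N (εG g j) (fm-truthV ψs one j) (fm-truthV ψs par j) (ys j) (primes j))))

    ⟦fm⟧⊆↓fm : ∀ φ w → ⟦ φ ⟧₀f w → proj₁ w N₀ fm φ
    ⟦fm⟧⊆↓fm (at p)    w w∈ = w∈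
    ⟦fm⟧⊆↓fm botF      w w∈ = w∈ (fm botF , tt) (λ _ ())
    ⟦fm⟧⊆↓fm topF      w _  = N-closed₀ (topR (proj₁ w))
    ⟦fm⟧⊆↓fm (φ ∧F ψ)  w (w∈φ , w∈ψ) =
      N-closed₂ (∧R φ ψ (proj₁ w)) (⟦fm⟧⊆↓fm φ w w∈φ) (⟦fm⟧⊆↓fm ψ w w∈ψ)
    ⟦fm⟧⊆↓fm (φ ∨F ψ)  w w∈ = w∈ (fm (φ ∨F ψ) , tt) λ where
      w′ (inj₁ w′∈φ) → N-closed₁ (∨R₁ φ ψ (proj₁ w′)) (⟦fm⟧⊆↓fm φ w′ w′∈φ)
      w′ (inj₂ w′∈ψ) → N-closed₁ (∨R₂ ψ φ (proj₁ w′)) (⟦fm⟧⊆↓fm ψ w′ w′∈ψ)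
    ⟦fm⟧⊆↓fm (fc f φs) w w∈ = w∈ (fm (fc f φs) , tt) λ zs primes →
      N-closed (dle (fR f (tabulate (proj₁ ∘ zs)) φs)) (toList⁺ (tabulate⁺ λ j →
        subst (λ t → Nₛ (premF L (εF f j) t (lookup φs j))) (sym (lookup∘tabulate (proj₁ ∘ zs) j))
          (premF-N (εF f j) (fm-truthV φs one j) (fm-truthV φs par j) (zs j) (primes j))))
    ⟦fm⟧⊆↓fm (gc g ψs) w w∈ =
      N-closed₁ (gR g ψs (proj₁ w))
        (subst (λ t → proj₁ w N₀ SG (gB g) t) (tabulate-∘lookup fm ψs)
          (w∈ (λ j → fm (lookup ψs j) , tt)
              (λ j → primeG-flip (εG g j) _ _ (fm-truthV ψs (flip (εG g j)) j))))

    fm-truth : ∀ p φ → primeF₀ p ⟦ φ ⟧₀f (fm φ , tt)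
    fm-truth one = fm∈⟦fm⟧
    fm-truth par = ⟦fm⟧⊆↓fm

    fm-truthV : ∀ {n} (φs : Vec (Fm L) n) p j →
                primeF₀ p (lookup ⟦ φs ⟧₀fV j) (fm (lookup φs j) , tt)
    fm-truthV (φ ∷ φs) p zero    = fm-truth p φ
    fm-truthV (φ ∷ φs) p (suc j) = fm-truthV φs p j

  TruthfulV : ∀ {n} → Vec (Str L) n → Set
  TruthfulV xs = ∀ p j (s : Sorted L p (lookup xs j)) → primeF₀ p (lookup ⟦ xs ⟧₀V j) (lookup xs j , s)

  fOp-∋-[]≔ : (f : FCon) (xs : Vec (Str L) (arF f)) (i : Fin (arF f)) {a : PW₀} {z : Str L} →
              TruthfulV xs → (∀ s → primeF₀ (εF f i) a (z , s)) →
              (sz : SortedV L (εF f) (xs [ i ]≔ z)) →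
              fOp L ρ s₀ f (⟦ xs ⟧₀V [ i ]≔ a) (SF (fB f) (xs [ i ]≔ z) , sz)
  fOp-∋-[]≔ f xs i {a} {z} truthful z-prime sz =
    fOp-∋ f (⟦ xs ⟧₀V [ i ]≔ a) (xs [ i ]≔ z) sz
      ([]≔-pointwise (εF f) (λ j → primeF₀ (εF f j)) ⟦ xs ⟧₀V xs i
        (λ j _ → truthful (εF f j) j) z-prime)

  gOp-N-[]≔ : (g : GCon) (ys : Vec (Str L) (arG g)) (i : Fin (arG g)) {a : PW₀} {z : Str L} →
              TruthfulV ys → (∀ s → primeG₀ (εG g i) a (z , s)) →
              (sz : SortedV L (flip ∘ εG g) (ys [ i ]≔ z)) →
              (w : W L ρ s₀) → gOp L ρ s₀ g (⟦ ys ⟧₀V [ i ]≔ a) w →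
              proj₁ w N₀ SG (gB g) (ys [ i ]≔ z)
  gOp-N-[]≔ g ys i {a} {z} truthful z-prime sz w w∈ =
    gOp-N g (⟦ ys ⟧₀V [ i ]≔ a) w w∈ (ys [ i ]≔ z) sz
      ([]≔-pointwise (flip ∘ εG g) (λ j → primeG₀ (εG g j)) ⟦ ys ⟧₀V ys i
        (λ j _ s → primeG-flip (εG g j) _ _ (truthful (flip (εG g j)) j s)) z-prime)

  truth-SF-fB : (f : FCon) (xs : Vec (Str L) (arF f)) → TruthfulV xs →
                (s : Sorted L one (SF (fB f) xs)) → ⟦ SF (fB f) xs ⟧₀ (SF (fB f) xs , s)
  truth-SF-fB f xs truthful s = fOp-∋ f ⟦ xs ⟧₀V xs s (λ j → truthful (εF f j) j)

  truth-SG-gB : (g : GCon) (ys : Vec (Str L) (arG g)) → TruthfulV ys →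
                (s : Sorted L par (SG (gB g) ys)) →
                ∀ w → ⟦ SG (gB g) ys ⟧₀ w → proj₁ w N₀ SG (gB g) ys
  truth-SG-gB g ys truthful s w w∈ =
    gOp-N g ⟦ ys ⟧₀V w w∈ ys s (λ j s′ → primeG-flip (εG g j) _ _ (truthful (flip (εG g j)) j s′))

  -- Residual cases: put the argument u (resp. w) into the i-th slot; the hypothesis
  -- then relates the displayed f- or g-structure to the i-th component, and a display
  -- rule turns that sequent back into the goal.
  truth-SF-fSh : (f : FCon) (i : Fin (arF f)) (e : εF f i ≡ par) (xs : Vec (Str L) (arF f)) →
                 TruthfulV xs → (s : Sorted L one (SF (fSh f i e) xs)) →
                 ⟦ SF (fSh f i e) xs ⟧₀ (SF (fSh f i e) xs , s)
  truth-SF-fSh f i e xs truthful s (u , su) FOp⊆xᵢ =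
    subst₂ _N₀_ (cong (SF (fSh f i e)) ([]≔-restore xs i u)) (lookup∘update i xs u)
      (N-closed₁ (dF∂↓ f (xs [ i ]≔ u) (lookup xs i) i e)
        (truthful par i xᵢ-par (_ , sz)
          (FOp⊆xᵢ _ (fOp-∋-[]≔ f xs i truthful (↓-primeF e (u , su)) sz))))
    where
    sz : SortedV L (εF f) (xs [ i ]≔ u)
    sz = SortedV-[]≔ s (Sorted-cast u (sym e) su) (λ j _ → resε-par _ (εF f) i e j)
    xᵢ-par : Sorted L par (lookup xs i)
    xᵢ-par = SortedV-lookup-cast s i (trans (resε-self _ (εF f) i) e)

  truth-SF-gFl : (g : GCon) (i : Fin (arG g)) (e : εG g i ≡ one) (ys : Vec (Str L) (arG g)) →
                 TruthfulV ys → (s : Sorted L one (SF (gFl g i e) ys)) →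
                 ⟦ SF (gFl g i e) ys ⟧₀ (SF (gFl g i e) ys , s)
  truth-SF-gFl g i e ys truthful s (u , su) yᵢ⊆GOp =
    subst₂ _N₀_ (cong (SF (gFl g i e)) ([]≔-restore ys i u)) (lookup∘update i ys u)
      (N-closed₁ (dG1↓ g (ys [ i ]≔ u) (lookup ys i) i e)
        (gOp-N-[]≔ g ys i truthful (↓-primeG e (u , su)) sz
          (_ , yᵢ-one) (yᵢ⊆GOp _ (truthful one i yᵢ-one))))
    where
    sz : SortedV L (flip ∘ εG g) (ys [ i ]≔ u)
    sz = SortedV-[]≔ s (Sorted-cast u (cong flip (sym e)) su) (resε-one _ (εG g) i e)
    yᵢ-one : Sorted L one (lookup ys i)
    yᵢ-one = SortedV-lookup-cast s i (trans (resε-self _ (εG g) i) e)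

  truth-SG-fSh : (f : FCon) (i : Fin (arF f)) (e : εF f i ≡ one) (xs : Vec (Str L) (arF f)) →
                 TruthfulV xs → (s : Sorted L par (SG (fSh f i e) xs)) →
                 ∀ w → ⟦ SG (fSh f i e) xs ⟧₀ w → proj₁ w N₀ SG (fSh f i e) xs
  truth-SG-fSh f i e xs truthful s w@(x , sx) FOp⊆xᵢ =
    subst₂ _N₀_ (lookup∘update i xs x) (cong (SG (fSh f i e)) ([]≔-restore xs i x))
      (N-closed₁ (dF1↓ f (xs [ i ]≔ x) (lookup xs i) i e)
        (truthful par i xᵢ-par (_ , sz) (FOp⊆xᵢ _ (fOp-∋-[]≔ f xs i truthful (↑↓-primeF e w) sz))))
    where
    sz : SortedV L (εF f) (xs [ i ]≔ x)
    sz = SortedV-[]≔ s (Sorted-cast x (sym e) sx)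
           (λ j j≢i → trans (cong flip (resε-one _ (εF f) i e j j≢i)) (flip-involutive (εF f j)))
    xᵢ-par : Sorted L par (lookup xs i)
    xᵢ-par = SortedV-lookup-cast s i (cong flip (trans (resε-self _ (εF f) i) e))

  truth-SG-gFl : (g : GCon) (i : Fin (arG g)) (e : εG g i ≡ par) (ys : Vec (Str L) (arG g)) →
                 TruthfulV ys → (s : Sorted L par (SG (gFl g i e) ys)) →
                 ∀ w → ⟦ SG (gFl g i e) ys ⟧₀ w → proj₁ w N₀ SG (gFl g i e) ys
  truth-SG-gFl g i e ys truthful s w@(x , sx) yᵢ⊆GOp =
    subst₂ _N₀_ (lookup∘update i ys x) (cong (SG (gFl g i e)) ([]≔-restore ys i x))
      (N-closed₁ (dG∂↓ g (ys [ i ]≔ x) (lookup ys i) i e)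
        (gOp-N-[]≔ g ys i truthful (↑↓-primeG e w) sz
          (_ , yᵢ-one) (yᵢ⊆GOp _ (truthful one i yᵢ-one))))
    where
    sz : SortedV L (flip ∘ εG g) (ys [ i ]≔ x)
    sz = SortedV-[]≔ s (Sorted-cast x (cong flip (sym e)) sx) (λ j _ → cong flip (resε-par _ (εG g) i e j))
    yᵢ-one : Sorted L one (lookup ys i)
    yᵢ-one = SortedV-lookup-cast s i (cong flip (trans (resε-self _ (εG g) i) e))

  mutual
    truth : ∀ p x (s : Sorted L p x) → primeF₀ p ⟦ x ⟧₀ (x , s)
    truth p   (fm φ)              tt = fm-truth p φ
    truth one (SF (fB f) xs)      s  = truth-SF-fB f xs (truthV xs) s
    truth one (SF (fSh f i e) xs) s  = truth-SF-fSh f i e xs (truthV xs) s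
    truth one (SF (gFl g i e) ys) s  = truth-SF-gFl g i e ys (truthV ys) s
    truth par (SG (gB g) ys)      s  = truth-SG-gB g ys (truthV ys) s
    truth par (SG (fSh f i e) xs) s  = truth-SG-fSh f i e xs (truthV xs) s
    truth par (SG (gFl g i e) ys) s  = truth-SG-gFl g i e ys (truthV ys) s
    truth par (SF _ _)            ()
    truth one (SG _ _)            ()

    truthV : ∀ {n} (xs : Vec (Str L) n) → TruthfulV xs
    truthV (x ∷ xs) p zero    = truth p x
    truthV (x ∷ xs) p (suc j) = truthV xs p j

proposition6p5 : (L : Sig) {I : Set} (ρ : I → Rule L) → (∀ i → Analytic L (ρ i)) →
                 (x y : Str L) → Sorted L one x → Sorted L par y →
                 ¬ Derivable L ρ (x , y) → ¬ Models L ρ (x , y) (x , y)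
proposition6p5 L ρ _ x y sx sy ⊬x⇒y ⊨x⇒y
  with truth par y sy (x , sx) (⊨x⇒y v₀ (λ p → ptDown-stable _) (x , sx) (truth one x sx))
  where open Canonical L ρ (x , y)
... | inj₁ ⊢x⇒y   = ⊬x⇒y ⊢x⇒y
... | inj₂ x⇒y∉ = x⇒y∉ base
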